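{- None of the following classes of graphs is $\mathrm{CMSOL}$-definable in the vocabulary of graphs, even in the presence of a linear order: Hamiltonian graphs; graphs having a perfect matching; cage graphs; well-covered graphs.
   Context: Graphs are finite simple undirected graphs, represented as structures $(V,E)$ whose universe is the vertex set and $E$ is the binary edge relation (the vocabulary of graphs). $\mathrm{CMSOL}$ is monadic second-order logic extended by the modular counting quantifiers $\mathrm{D}_{m,i}x\,\phi(x)$, expressing that the number of elements $x$ satisfying $\phi$ is congruent to $i$ modulo $m$. A class $\mathcal{C}$ is $\mathrm{CMSOL}$-definable as graphs in the presence of an order if there is a $\mathrm{CMSOL}$-sentence $\varphi$ over $\{E,<\}$ such that for every finite graph $G$ and every linear order $<$ on $V(G)$: $(V(G),E(G),<)\models\varphi$ iff $G\in\mathcal{C}$. A cage graph is a regular graph with as few vertices as possible for its girth. A well-covered graph is one in which every minimal vertex cover has the same size as every other minimal vertex cover. -}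

module Defs where

open import Data.Nat using (ℕ; zero; suc; _+_; _∸_; _≤_; _<_; _%_; _≡ᵇ_; NonZero)
open import Data.Bool using (Bool; true; false; not; _∧_; if_then_else_)
open import Data.Fin using (Fin; toℕ) renaming (zero to fzero; suc to fsuc)
open import Data.Fin.Properties using () renaming (_≟_ to _≟F_)
open import Data.Bool.ListAction using (any)
open import Data.List using (List; []; _∷_; allFin; concatMap; map; foldr)
open import Data.Product using (Σ; _×_; _,_)
open import Data.Sum using (_⊎_)
open import Function using (_⇔_)
open import Function.Definitions using (Injective)
open import Relation.Nullary using (¬_)
open import Relation.Nullary.Decidable using (isYes)
open import Relation.Binary.PropositionalEquality using (_≡_; _≢_)

record Graph (n : ℕ) : Set where
  field
    E     : Fin n → Fin n → Bool
    irrefl : ∀ i → E i i ≡ false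
    sym   : ∀ i j → E i j ≡ E j i
open Graph public

record LinOrder (n : ℕ) : Set where
  field
    lt      : Fin n → Fin n → Bool
    irrefl  : ∀ i → lt i i ≡ false
    trans   : ∀ i j k → lt i j ≡ true → lt j k ≡ true → lt i k ≡ true
    total   : ∀ i j → i ≢ j → (lt i j ≡ true) ⊎ (lt j i ≡ true)
open LinOrder public

count : ∀ {n} → (Fin n → Bool) → ℕ
count {n} P = foldr (λ x c → if P x then suc c else c) 0 (allFin n)

consB : ∀ {n} → Bool → (Fin n → Bool) → Fin (suc n) → Bool
consB b S fzero    = b
consB b S (fsuc i) = S i

subsets : (n : ℕ) → List (Fin n → Bool)
subsets zero    = (λ ()) ∷ []
subsets (suc n) = concatMap (λ S → consB false S ∷ consB true S ∷ []) (subsets n)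

-- CMSOL over the vocabulary {E, <} with de Bruijn variables:
-- k first-order variables, m monadic second-order (set) variables.

data Formula (k m : ℕ) : Set where
  edge  : Fin k → Fin k → Formula k m
  less  : Fin k → Fin k → Formula k m
  equal : Fin k → Fin k → Formula k m
  mem   : Fin k → Fin m → Formula k m
  neg   : Formula k m → Formula k m
  conj  : Formula k m → Formula k m → Formula k m
  ex1   : Formula (suc k) m → Formula k m
  ex2   : Formula k (suc m) → Formula k m
  cnt   : (p : ℕ) → {{NonZero p}} → (i : ℕ) → Formula (suc k) m → Formula k m

Sentence : Set
Sentence = Formula 0 0

extend : ∀ {k} {A : Set} → A → (Fin k → A) → Fin (suc k) → A
extend a ρ fzero    = a
extend a ρ (fsuc i) = ρ i

eval : ∀ {n k m} → Graph n → LinOrder n → Formula k m →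
       (Fin k → Fin n) → (Fin m → Fin n → Bool) → Bool
eval G O (edge x y)  ρ σ = E G (ρ x) (ρ y)
eval G O (less x y)  ρ σ = lt O (ρ x) (ρ y)
eval G O (equal x y) ρ σ = isYes (ρ x ≟F ρ y)
eval G O (mem x X)   ρ σ = σ X (ρ x)
eval G O (neg φ)     ρ σ = not (eval G O φ ρ σ)
eval G O (conj φ ψ)  ρ σ = eval G O φ ρ σ ∧ eval G O ψ ρ σ
eval {n} G O (ex1 φ) ρ σ = any (λ a → eval G O φ (extend a ρ) σ) (allFin n)
eval {n} G O (ex2 φ) ρ σ = any (λ S → eval G O φ ρ (extend S σ)) (subsets n)
eval G O (cnt p i φ) ρ σ =
  (count (λ a → eval G O φ (extend a ρ) σ) % p) ≡ᵇ (i % p)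

_,_⊨_ : ∀ {n} → Graph n → LinOrder n → Sentence → Set
G , O ⊨ φ = eval G O φ (λ ()) (λ ()) ≡ true

GraphClass : Set₁
GraphClass = ∀ {n} → Graph n → Set

CMSOLDefinableWithOrder : GraphClass → Set
CMSOLDefinableWithOrder C =
  Σ Sentence λ φ → ∀ n (G : Graph n) (O : LinOrder n) → ((G , O ⊨ φ) ⇔ C G)

CycSucc : ∀ {ℓ} → Fin ℓ → Fin ℓ → Set
CycSucc {ℓ} i j = (toℕ j ≡ suc (toℕ i)) ⊎ ((toℕ i ≡ ℓ ∸ 1) × (toℕ j ≡ 0))

HasCycleOfLength : ∀ {n} → Graph n → ℕ → Set
HasCycleOfLength {n} G ℓ =
  3 ≤ ℓ × Σ (Fin ℓ → Fin n) λ c → Injective _≡_ _≡_ c ×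
    (∀ i j → CycSucc i j → E G (c i) (c j) ≡ true)

Hamiltonian : GraphClass
Hamiltonian {n} G = HasCycleOfLength G n

HasPerfectMatching : GraphClass
HasPerfectMatching {n} G =
  Σ (Fin n → Fin n → Bool) λ M →
    (∀ u v → M u v ≡ true → E G u v ≡ true) ×
    (∀ u v → M u v ≡ M v u) ×
    (∀ v → Σ (Fin n) λ u → (M v u ≡ true) × (∀ w → M v w ≡ true → w ≡ u))

degree : ∀ {n} → Graph n → Fin n → ℕ
degree G v = count (E G v)

Regular : ∀ {n} → Graph n → ℕ → Set
Regular G r = ∀ v → degree G v ≡ r

Girth : ∀ {n} → Graph n → ℕ → Set
Girth G g = HasCycleOfLength G g × (∀ ℓ → ℓ < g → ¬ HasCycleOfLength G ℓ)

Cage : GraphClass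
Cage {n} G = Σ ℕ λ r → Σ ℕ λ g → Regular G r × Girth G g ×
  (∀ m (H : Graph m) → Regular H r → Girth H g → n ≤ m)

VertexCover : ∀ {n} → Graph n → (Fin n → Bool) → Set
VertexCover {n} G S = ∀ u v → E G u v ≡ true → (S u ≡ true) ⊎ (S v ≡ true)

MinimalVertexCover : ∀ {n} → Graph n → (Fin n → Bool) → Set
MinimalVertexCover {n} G S = VertexCover G S ×
  (∀ T → (∀ v → T v ≡ true → S v ≡ true) → VertexCover G T → ∀ v → T v ≡ S v)

WellCovered : GraphClass
WellCovered {n} G = ∀ S T → MinimalVertexCover G S → MinimalVertexCover G T →
  count S ≡ count T

-- On the complete bipartite graph K a b whose vertices are ordered with one side first, a CMSOL sentence
-- over {E, <} is decided by a finite automaton reading the word of sides 1^a 0^b: edges and order are read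
-- off the positions of the free variables, a set quantifier is a subset construction, and ∃x and the
-- counting quantifiers D_{p,i}x are automata that, for each state, count in a finite homomorphic image of
-- (ℕ, +) the positions x whose run ends there. By pigeonhole this automaton reaches the same state on the
-- blocks 0^a and 0^b for some 2 ≤ a < b, so the sentence cannot separate K a a from K a b. Yet K a a is
-- Hamiltonian, has a perfect matching, is an (a,4)-cage (two adjacent vertices of an a-regular graph
-- without triangles have 2a distinct neighbours) and is well-covered (its minimal vertex covers are its
-- two sides), whereas K a b has none of these properties: Hamiltonian cycles and perfect matchings
-- alternate between the sides, it is not regular, and its two sides are minimal covers of different sizes.

module Submission where

open import Defs hiding (sym; trans; irrefl)

open import Algebra.Properties.CommutativeMonoid.Sum as CommutativeMonoidSum using ()
open import Data.Bool using (Bool; true; false; not; _∧_; _∨_; _xor_; if_then_else_)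
open import Data.Bool.ListAction using (any; or)
open import Data.Bool.Properties
  using (∨-commutativeMonoid; ∨-identityʳ; ∨-assoc; ∧-distribʳ-∨; if-eta; if-float; ¬-not; xor-same; xor-comm;
         xor-inverseʳ; xor-annihilates-not; T-≡; ⇔→≡)
  renaming (_≟_ to _≟ᵇ_)
open import Data.Empty using (⊥)
open import Data.Fin using (Fin; zero; suc; toℕ; fromℕ<; _↑ˡ_; _↑ʳ_; splitAt; join; punchIn; punchOut)
open import Data.Fin.Patterns using (0F; 1F; 2F)
open import Data.Fin.Properties
  using (_≟_; 2↔Bool; *↔×; toℕ-injective; toℕ-fromℕ<; toℕ<n; toℕ-↑ˡ; toℕ-↑ʳ; ↑ˡ-injective; ↑ʳ-injective; suc-injective;
         splitAt-join; join-splitAt; splitAt⁻¹-↑ˡ; splitAt⁻¹-↑ʳ; punchIn-punchOut; punchOut-injective; pigeonhole; any?)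
  renaming (<-cmp to <-cmpᶠ)
open import Data.List as List using (List; []; _∷_; allFin; tabulate)
open import Data.List.Properties using (map-cong)
open import Data.Maybe using (Maybe; just; nothing; maybe′; is-just)
open import Data.Nat
  using (ℕ; zero; suc; pred; _+_; _*_; _^_; _∸_; _≤_; _<_; _<ᵇ_; _%_; _≡ᵇ_; NonZero; s≤s; s≤s⁻¹; z≤n; ⌊_/2⌋)
open import Data.Nat.DivMod using (_mod_; %-distribˡ-+; m%n<n)
open import Data.Nat.GeneralisedArithmetic using (fold)
open import Data.Nat.Properties
  using (+-0-commutativeMonoid; +-identityʳ; +-suc; +-mono-≤; <-trans; <-irrefl; <-≤-trans; ≤-refl; ≤-trans;
         <⇒≢; m+n≮m; n≤1+n; n<1+n; <ᵇ⇒<; <⇒<ᵇ; module ≤-Reasoning)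
open import Data.Product using (∃₂; _×_; _,_; proj₁; proj₂; uncurry)
open import Data.Product.Function.NonDependent.Propositional using (_×-↔_)
open import Data.Sum using (_⊎_; inj₁; inj₂; swap)
open import Data.Sum.Properties using (swap-involutive)
open import Data.Vec using (Vec; []; _∷_; lookup) renaming (tabulate to tabulateᵛ)
open import Data.Vec.Functional using (foldr)
open import Data.Vec.Properties using (lookup∘tabulate)
open import Data.Vec.Recursive as Tuple using (fromVec; toVec; lift↔; Fin[m^n]↔Fin[m]^n)
open import Data.Vec.Recursive.Properties using (fromVec∘toVec; toVec∘fromVec)
open import Function using (_∘_; id; _↔_; mk↔ₛ′; mk⇔; Inverse; module Equivalence)
open import Function.Definitions using (Injective)
open import Function.Properties.Inverse using (↔-refl; ↔-sym; ↔-trans)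
open import Relation.Binary.Definitions using (tri<; tri≈; tri>)
open import Relation.Binary.PropositionalEquality
open import Relation.Nullary using (¬_; yes; no; contradiction)
open import Relation.Nullary.Decidable using (isYes; _×-dec_)

private variable
  k m n : ℕ
  A B L S : Set

module ∑ℕ = CommutativeMonoidSum +-0-commutativeMonoid
module ⋁  = CommutativeMonoidSum ∨-commutativeMonoid

_==_ : Fin n → Fin n → Bool
zero  == zero  = true
zero  == suc _ = false
suc _ == zero  = false
suc i == suc j = i == j

==-refl : (i : Fin n) → (i == i) ≡ true
==-refl zero    = refl
==-refl (suc i) = ==-refl i

==⇒≡ : (i j : Fin n) → (i == j) ≡ true → i ≡ j
==⇒≡ zero    zero    _  = refl
==⇒≡ (suc i) (suc j) eq = cong suc (==⇒≡ i j eq)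

≡⇒== : {i j : Fin n} → i ≡ j → (i == j) ≡ true
≡⇒== {i = i} refl = ==-refl i

isYes-≟ : (i j : Fin n) → isYes (i ≟ j) ≡ (i == j)
isYes-≟ i j with i ≟ j | i == j in eq
... | yes refl | true  = refl
... | yes refl | false = contradiction (trans (sym eq) (==-refl i)) λ ()
... | no  _    | false = refl
... | no  i≢j  | true  = contradiction (==⇒≡ i j eq) i≢j

==-involution : (f : Fin n → Fin n) → (∀ u → f (f u) ≡ u) → ∀ u v → (f u == v) ≡ (f v == u)
==-involution f f∘f≡id u v = ⇔→≡ {z = true} (mk⇔ (reverse u v) (reverse v u))
  where
  reverse : ∀ u v → (f u == v) ≡ true → (f v == u) ≡ true
  reverse u v fu≡v = ≡⇒== (trans (cong f (sym (==⇒≡ _ _ fu≡v))) (f∘f≡id u))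

xor≡true⇒≡not : ∀ x y → x xor y ≡ true → y ≡ not x
xor≡true⇒≡not true  false _ = refl
xor≡true⇒≡not false true  _ = refl

𝟙 : Bool → ℕ
𝟙 b = if b then 1 else 0

∑ : (Fin n → ℕ) → ℕ
∑ = ∑ℕ.sum

# : (Fin n → Bool) → ℕ
# P = ∑ (𝟙 ∘ P)

⋁ : (Fin n → Bool) → Bool
⋁ = ⋁.sum

foldr-cong : (f : A → S → S) (s : S) {xs ys : Fin n → A} → (∀ i → xs i ≡ ys i) →
             foldr f s xs ≡ foldr f s ys
foldr-cong {n = zero}  f s eq = refl
foldr-cong {n = suc n} f s eq = cong₂ f (eq zero) (foldr-cong f s (eq ∘ suc))

foldr-× : (f : L → A → A) (g : L → B → B) (a : A) (b : B) (xs : Fin n → L) →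
          foldr (λ l (x , y) → f l x , g l y) (a , b) xs ≡ (foldr f a xs , foldr g b xs)
foldr-× {n = zero}  f g a b xs = refl
foldr-× {n = suc n} f g a b xs rewrite foldr-× f g a b (xs ∘ suc) = refl

count≡# : (P : Fin n → Bool) → count P ≡ # P
count≡# {n} P = go id
  where
  go : ∀ {k} (f : Fin k → Fin n) → List.foldr (λ x c → if P x then suc c else c) 0 (tabulate f) ≡ # (P ∘ f)
  go {zero}  f = refl
  go {suc k} f with P (f zero)
  ... | true  = cong suc (go (f ∘ suc))
  ... | false = go (f ∘ suc)

any≡⋁ : (P : Fin n → Bool) → any P (allFin n) ≡ ⋁ P
any≡⋁ {n} P = go id
  where
  go : ∀ {k} (f : Fin k → Fin n) → any P (tabulate f) ≡ ⋁ (P ∘ f)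
  go {zero}  f = refl
  go {suc k} f = cong (P (f zero) ∨_) (go (f ∘ suc))

#-true : # {n} (λ _ → true) ≡ n
#-true {zero}  = refl
#-true {suc n} = cong suc (#-true {n})

∑-zero : {f : Fin n → ℕ} → (∀ i → f i ≡ 0) → ∑ f ≡ 0
∑-zero {zero}  f≡0 = refl
∑-zero {suc n} f≡0 rewrite f≡0 zero = ∑-zero (f≡0 ∘ suc)

∑-select : (i : Fin n) (g : Fin n → Bool) → ∑ (λ j → if g j then 𝟙 (i == j) else 0) ≡ 𝟙 (g i)
∑-select {suc n} zero g = trans (cong (𝟙 (g zero) +_) (∑-zero (λ j → if-eta (g (suc j))))) (+-identityʳ _)
∑-select {suc n} (suc i) g with g zero
... | true  = ∑-select i (g ∘ suc)
... | false = ∑-select i (g ∘ suc)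

if-+ : ∀ b x y → (if b then x else 0) + (if b then y else 0) ≡ (if b then x + y else 0)
if-+ true  x y = refl
if-+ false x y = refl

#-≤ : (P : Fin n → Bool) → # P ≤ n
#-≤ {zero}  P = z≤n
#-≤ {suc n} P with P zero
... | true  = s≤s (#-≤ (P ∘ suc))
... | false = ≤-trans (#-≤ (P ∘ suc)) (n≤1+n n)

#-∨ : (P R : Fin n → Bool) → (∀ i → P i ∧ R i ≡ false) → # (λ i → P i ∨ R i) ≡ # P + # R
#-∨ P R disjoint = trans (foldr-cong _+_ 0 (λ i → 𝟙-∨ (P i) (R i) (disjoint i))) (∑ℕ.∑-distrib-+ (𝟙 ∘ P) (𝟙 ∘ R))
  where
  𝟙-∨ : ∀ x y → x ∧ y ≡ false → 𝟙 (x ∨ y) ≡ 𝟙 x + 𝟙 y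
  𝟙-∨ true  false _ = refl
  𝟙-∨ false y     _ = refl

#∘injective : (f : Fin n → Fin n) → Injective _≡_ _≡_ f → (P : Fin n → Bool) → # (P ∘ f) ≡ # P
#∘injective {zero}  f f-inj P = refl
#∘injective {suc n} f f-inj P = begin
  𝟙 (P t) + # (P ∘ f ∘ suc)
    ≡⟨ cong (𝟙 (P t) +_) (foldr-cong _+_ 0 (λ i → cong (𝟙 ∘ P) (punchIn-punchOut (t≢ i)))) ⟨
  𝟙 (P t) + # (P ∘ punchIn t ∘ g)
    ≡⟨ cong (𝟙 (P t) +_) (#∘injective g g-inj (P ∘ punchIn t)) ⟩
  𝟙 (P t) + # (P ∘ punchIn t)
    ≡⟨ ∑ℕ.sum-remove (𝟙 ∘ P) ⟨
  # P ∎
  where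
  open ≡-Reasoning
  t = f zero
  t≢ : ∀ i → t ≢ f (suc i)
  t≢ i eq with f-inj eq
  ... | ()
  g : Fin n → Fin n
  g i = punchOut (t≢ i)
  g-inj : Injective _≡_ _≡_ g
  g-inj {i} {j} eq = suc-injective (f-inj (punchOut-injective (t≢ i) (t≢ j) eq))

alternating⇒balanced : (g : Fin n → Fin n) → Injective _≡_ _≡_ g → (P : Fin n → Bool) →
                       (∀ i → P (g i) ≡ not (P i)) → # P ≡ # (not ∘ P)
alternating⇒balanced g g-inj P alternates =
  trans (sym (#∘injective g g-inj P)) (foldr-cong _+_ 0 (cong 𝟙 ∘ alternates))

⋁-select : (i : Fin n) (P : Fin n → Bool) → ⋁ (λ j → (i == j) ∧ P j) ≡ P i
⋁-select {suc n} zero    P = trans (cong (P zero ∨_) (⋁.sum-replicate-zero n)) (∨-identityʳ (P zero))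
⋁-select {suc n} (suc i) P = ⋁-select i (P ∘ suc)

⋁-image : (f : A → Fin n) (P : Fin n → Bool) (xs : List A) →
          ⋁ (λ j → any (λ x → f x == j) xs ∧ P j) ≡ any (P ∘ f) xs
⋁-image {n = n} f P []       = ⋁.sum-replicate-zero n
⋁-image         f P (x ∷ xs) = begin
  ⋁ (λ j → (f x == j ∨ any (λ y → f y == j) xs) ∧ P j)
    ≡⟨ foldr-cong _∨_ false (λ j → ∧-distribʳ-∨ (P j) (f x == j) _) ⟩
  ⋁ (λ j → (f x == j) ∧ P j ∨ any (λ y → f y == j) xs ∧ P j)
    ≡⟨ ⋁.∑-distrib-+ (λ j → (f x == j) ∧ P j) (λ j → any (λ y → f y == j) xs ∧ P j) ⟩
  ⋁ (λ j → (f x == j) ∧ P j) ∨ ⋁ (λ j → any (λ y → f y == j) xs ∧ P j)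
    ≡⟨ cong₂ _∨_ (⋁-select (f x) P) (⋁-image f P xs) ⟩
  P (f x) ∨ any (P ∘ f) xs ∎
  where open ≡-Reasoning

any-cong : {p q : A → Bool} → (∀ x → p x ≡ q x) → (xs : List A) → any p xs ≡ any q xs
any-cong p≗q xs = cong or (map-cong p≗q xs)

any-subsets-suc : (p : (Fin (suc n) → Bool) → Bool) →
                  any p (subsets (suc n)) ≡ any (λ S → p (consB false S) ∨ p (consB true S)) (subsets n)
any-subsets-suc {n} p = go (subsets n)
  where
  go : (Ss : List (Fin _ → Bool)) →
       any p (List.concatMap (λ S → consB false S ∷ consB true S ∷ []) Ss)
       ≡ any (λ S → p (consB false S) ∨ p (consB true S)) Ss
  go []       = refl
  go (S ∷ Ss) = trans (cong (λ b → p (consB false S) ∨ (p (consB true S) ∨ b)) (go Ss))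
                      (sym (∨-assoc (p (consB false S)) (p (consB true S)) _))

record Finite (A : Set) : Set where
  field
    size        : ℕ
    enumeration : A ↔ Fin size
  open Inverse enumeration public
    using () renaming (to to index; from to element; strictlyInverseʳ to element-index)

finite-Bool : Finite Bool
finite-Bool = record { size = 2 ; enumeration = ↔-sym 2↔Bool }

finite-Fin : Finite (Fin n)
finite-Fin = record { size = _ ; enumeration = ↔-refl }

finite-× : Finite A → Finite B → Finite (A × B)
finite-× FA FB = record
  { size        = Finite.size FA * Finite.size FB
  ; enumeration = ↔-trans (Finite.enumeration FA ×-↔ Finite.enumeration FB) (↔-sym *↔×)
  }

Vec↔Tuple : Vec A n ↔ A Tuple.^ n
Vec↔Tuple {n = n} = mk↔ₛ′ fromVec (toVec n) (fromVec∘toVec n) toVec∘fromVec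

finite-Vec : Finite A → ∀ n → Finite (Vec A n)
finite-Vec F n = record
  { size        = size ^ n
  ; enumeration = ↔-trans Vec↔Tuple (↔-trans (lift↔ n enumeration) (↔-sym (Fin[m^n]↔Fin[m]^n size n)))
  }
  where open Finite F

#-fibres : (F : Finite S) (r : Fin n → S) (P : S → Bool) → let open Finite F in
           # (P ∘ r) ≡ ∑ (λ c → if P (element c) then # (λ a → index (r a) == c) else 0)
#-fibres {n = zero}  F r P = sym (∑-zero (λ c → if-eta (P (Finite.element F c))))
#-fibres {n = suc n} F r P = begin
  𝟙 (P (r zero)) + # (P ∘ r ∘ suc)
    ≡⟨ cong₂ _+_ (sym (trans (∑-select (index (r zero)) (P ∘ element)) (cong (𝟙 ∘ P) (element-index (r zero)))))
                 (#-fibres F (r ∘ suc) P) ⟩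
  ∑ (λ c → if P (element c) then 𝟙 (index (r zero) == c) else 0)
    + ∑ (λ c → if P (element c) then # (λ a → index (r (suc a)) == c) else 0)
    ≡⟨ ∑ℕ.∑-distrib-+ (λ c → if P (element c) then 𝟙 (index (r zero) == c) else 0)
                      (λ c → if P (element c) then # (λ a → index (r (suc a)) == c) else 0) ⟨
  ∑ (λ c → (if P (element c) then 𝟙 (index (r zero) == c) else 0)
           + (if P (element c) then # (λ a → index (r (suc a)) == c) else 0))
    ≡⟨ foldr-cong _+_ 0 (λ c → if-+ (P (element c)) _ _) ⟩
  ∑ (λ c → if P (element c) then # (λ a → index (r a) == c) else 0) ∎
  where
  open Finite F
  open ≡-Reasoning

-- Automata deciding CMSOL on ordered complete bipartite graphs

<⇒<ᵇ≡true : ∀ {m n} → m < n → (m <ᵇ n) ≡ true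
<⇒<ᵇ≡true = Equivalence.to T-≡ ∘ <⇒<ᵇ

<ᵇ≡true⇒< : ∀ m n → (m <ᵇ n) ≡ true → m < n
<ᵇ≡true⇒< m n = <ᵇ⇒< m n ∘ Equivalence.from T-≡

≮⇒<ᵇ≡false : ∀ {m n} → ¬ m < n → (m <ᵇ n) ≡ false
≮⇒<ᵇ≡false {m} {n} m≮n = ¬-not (m≮n ∘ <ᵇ≡true⇒< m n)

natural : ∀ n → LinOrder n
natural n = record
  { lt     = λ i j → toℕ i <ᵇ toℕ j
  ; irrefl = λ i → ≮⇒<ᵇ≡false {toℕ i} (<-irrefl refl)
  ; trans  = λ i j k i<j j<k → <⇒<ᵇ≡true (<-trans (<ᵇ≡true⇒< _ _ i<j) (<ᵇ≡true⇒< _ (toℕ k) j<k))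
  ; total  = compare
  }
  where
  compare : ∀ (i j : Fin n) → i ≢ j → ((toℕ i <ᵇ toℕ j) ≡ true) ⊎ ((toℕ j <ᵇ toℕ i) ≡ true)
  compare i j i≢j with <-cmpᶠ i j
  ... | tri< i<j _ _ = inj₁ (<⇒<ᵇ≡true i<j)
  ... | tri≈ _ i≡j _ = contradiction i≡j i≢j
  ... | tri> _ _ j<i = inj₂ (<⇒<ᵇ≡true j<i)

bipartite : (Fin n → Bool) → Graph n
bipartite w = record
  { E      = λ i j → w i xor w j
  ; irrefl = λ i → xor-same (w i)
  ; sym    = λ i j → xor-comm (w i) (w j)
  }

firstSide : ∀ a b → Fin (a + b) → Bool
firstSide a b v = toℕ v <ᵇ a

K : ∀ a b → Graph (a + b)
K a b = bipartite (firstSide a b)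

Letter : ℕ → ℕ → Set
Letter k m = Bool × Vec Bool k × Vec Bool m

side : Letter k m → Bool
side = proj₁

pointedBy : Fin k → Letter k m → Bool
pointedBy x (_ , xs , _) = lookup xs x

inSet : Fin m → Letter k m → Bool
inSet X (_ , _ , Xs) = lookup Xs X

record DFA (k m : ℕ) : Set₁ where
  field
    State  : Set
    finite : Finite State
    start  : State
    step   : Letter k m → State → State
    accept : State → Bool

run : (A : DFA k m) → (Fin n → Letter k m) → DFA.State A
run A = foldr (DFA.step A) (DFA.start A)

annotate : (Fin n → Bool) → (Fin k → Fin n) → (Fin m → Fin n → Bool) → Fin n → Letter k m
annotate w ρ σ i = w i , tabulateᵛ (λ x → ρ x == i) , tabulateᵛ (λ X → σ X i)

Decides : DFA k m → Formula k m → Set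
Decides {k} {m} A φ = ∀ n (w : Fin n → Bool) (ρ : Fin k → Fin n) (σ : Fin m → Fin n → Bool) →
  DFA.accept A (run A (annotate w ρ σ)) ≡ eval (bipartite w) (natural n) φ ρ σ

markedAt : Maybe (Fin n) → Fin n → Bool
markedAt nothing  i = false
markedAt (just p) i = p == i

pointedBy-annotate : (w : Fin n → Bool) (ρ : Fin k → Fin n) (σ : Fin m → Fin n → Bool) (x : Fin k) (i : Fin n) →
                     pointedBy x (annotate w ρ σ i) ≡ markedAt (just (ρ x)) i
pointedBy-annotate w ρ σ x i = lookup∘tabulate (λ x → ρ x == i) x

inSet-annotate : (w : Fin n → Bool) (ρ : Fin k → Fin n) (σ : Fin m → Fin n → Bool) (X : Fin m) (i : Fin n) →
                 inSet X (annotate w ρ σ i) ≡ σ X i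
inSet-annotate w ρ σ X i = lookup∘tabulate (λ X → σ X i) X

dropFirst : Maybe (Fin (suc n)) → Maybe (Fin n)
dropFirst nothing        = nothing
dropFirst (just zero)    = nothing
dropFirst (just (suc p)) = just p

markedAt-dropFirst : (p : Maybe (Fin (suc n))) (i : Fin n) → markedAt p (suc i) ≡ markedAt (dropFirst p) i
markedAt-dropFirst nothing        i = refl
markedAt-dropFirst (just zero)    i = refl
markedAt-dropFirst (just (suc p)) i = refl

latch : (L → Bool) → (L → A) → L → A → A
latch marked value l a = if marked l then value l else a

foldr-latch : (marked : L → Bool) (value : L → A) (a : A) (xs : Fin n → L) (p : Maybe (Fin n)) →
              (∀ i → marked (xs i) ≡ markedAt p i) → foldr (latch marked value) a xs ≡ maybe′ (value ∘ xs) a p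
foldr-latch {n = zero}  mk val a xs nothing        marks = refl
foldr-latch {n = suc n} mk val a xs nothing        marks
  rewrite marks zero = foldr-latch mk val a (xs ∘ suc) nothing (marks ∘ suc)
foldr-latch {n = suc n} mk val a xs (just zero)    marks rewrite marks zero = refl
foldr-latch {n = suc n} mk val a xs (just (suc p)) marks
  rewrite marks zero = foldr-latch mk val a (xs ∘ suc) (just p) (marks ∘ suc)

before : Maybe (Fin n) → Maybe (Fin n) → Bool
before (just i) (just j) = toℕ i <ᵇ toℕ j
before _        _        = false

-- A run reads the word from its last letter, so seenY records an occurrence of y further right.
scanBefore : (L → Bool) → (L → Bool) → L → Bool × Bool → Bool × Bool
scanBefore markedX markedY l (seenY , answer) = (seenY ∨ markedY l) , (if markedX l then seenY else answer)

foldr-scanBefore : (markedX markedY : L → Bool) (xs : Fin n → L) (p q : Maybe (Fin n)) →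
                   (∀ i → markedX (xs i) ≡ markedAt p i) → (∀ i → markedY (xs i) ≡ markedAt q i) →
                   foldr (scanBefore markedX markedY) (false , false) xs ≡ (is-just q , before p q)
foldr-scanBefore {n = zero}  mx my xs nothing nothing marksX marksY = refl
foldr-scanBefore {n = suc n} mx my xs p q marksX marksY
  rewrite foldr-scanBefore mx my (xs ∘ suc) (dropFirst p) (dropFirst q)
            (λ i → trans (marksX (suc i)) (markedAt-dropFirst p i))
            (λ i → trans (marksY (suc i)) (markedAt-dropFirst q i))
        | marksX zero | marksY zero = step p q
  where
  step : (p q : Maybe (Fin (suc n))) →
         ((is-just (dropFirst q) ∨ markedAt q zero) ,
          (if markedAt p zero then is-just (dropFirst q) else before (dropFirst p) (dropFirst q)))
         ≡ (is-just q , before p q)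
  step nothing        nothing        = refl
  step nothing        (just zero)    = refl
  step nothing        (just (suc _)) = refl
  step (just zero)    nothing        = refl
  step (just zero)    (just zero)    = refl
  step (just zero)    (just (suc _)) = refl
  step (just (suc _)) nothing        = refl
  step (just (suc _)) (just zero)    = refl
  step (just (suc _)) (just (suc _)) = refl

edgeDFA : Fin k → Fin k → DFA k m
edgeDFA x y = record
  { State  = Bool × Bool
  ; finite = finite-× finite-Bool finite-Bool
  ; start  = false , false
  ; step   = λ l (a , b) → latch (pointedBy x) side l a , latch (pointedBy y) side l b
  ; accept = uncurry _xor_
  }

edgeDFA-decides : (x y : Fin k) → Decides {k} {m} (edgeDFA x y) (edge x y)
edgeDFA-decides x y n w ρ σ
  rewrite foldr-× (latch (pointedBy x) side) (latch (pointedBy y) side) false false (annotate w ρ σ)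
        | foldr-latch (pointedBy x) side false (annotate w ρ σ) (just (ρ x)) (pointedBy-annotate w ρ σ x)
        | foldr-latch (pointedBy y) side false (annotate w ρ σ) (just (ρ y)) (pointedBy-annotate w ρ σ y)
        = refl

lessDFA : Fin k → Fin k → DFA k m
lessDFA x y = record
  { State  = Bool × Bool
  ; finite = finite-× finite-Bool finite-Bool
  ; start  = false , false
  ; step   = scanBefore (pointedBy x) (pointedBy y)
  ; accept = proj₂
  }

lessDFA-decides : (x y : Fin k) → Decides {k} {m} (lessDFA x y) (less x y)
lessDFA-decides x y n w ρ σ
  rewrite foldr-scanBefore (pointedBy x) (pointedBy y) (annotate w ρ σ) (just (ρ x)) (just (ρ y))
            (pointedBy-annotate w ρ σ x) (pointedBy-annotate w ρ σ y)
        = refl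

equalDFA : Fin k → Fin k → DFA k m
equalDFA x y = record
  { State  = Bool
  ; finite = finite-Bool
  ; start  = false
  ; step   = latch (pointedBy y) (pointedBy x)
  ; accept = id
  }

equalDFA-decides : (x y : Fin k) → Decides {k} {m} (equalDFA x y) (equal x y)
equalDFA-decides x y n w ρ σ
  rewrite foldr-latch (pointedBy y) (pointedBy x) false (annotate w ρ σ) (just (ρ y)) (pointedBy-annotate w ρ σ y)
        | pointedBy-annotate w ρ σ x (ρ y)
        = sym (isYes-≟ (ρ x) (ρ y))

memDFA : Fin k → Fin m → DFA k m
memDFA x X = record
  { State  = Bool
  ; finite = finite-Bool
  ; start  = false
  ; step   = latch (pointedBy x) (inSet X)
  ; accept = id
  }

memDFA-decides : (x : Fin k) (X : Fin m) → Decides (memDFA x X) (mem x X)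
memDFA-decides x X n w ρ σ
  rewrite foldr-latch (pointedBy x) (inSet X) false (annotate w ρ σ) (just (ρ x)) (pointedBy-annotate w ρ σ x)
        = inSet-annotate w ρ σ X (ρ x)

negDFA : DFA k m → DFA k m
negDFA A = record A { accept = not ∘ DFA.accept A }

negDFA-decides : (A : DFA k m) (φ : Formula k m) → Decides A φ → Decides (negDFA A) (neg φ)
negDFA-decides A φ A⊢φ n w ρ σ = cong not (A⊢φ n w ρ σ)

conjDFA : DFA k m → DFA k m → DFA k m
conjDFA A B = record
  { State  = DFA.State A × DFA.State B
  ; finite = finite-× (DFA.finite A) (DFA.finite B)
  ; start  = DFA.start A , DFA.start B
  ; step   = λ l (a , b) → DFA.step A l a , DFA.step B l b
  ; accept = λ (a , b) → DFA.accept A a ∧ DFA.accept B b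
  }

conjDFA-decides : (A B : DFA k m) (φ ψ : Formula k m) → Decides A φ → Decides B ψ → Decides (conjDFA A B) (conj φ ψ)
conjDFA-decides A B φ ψ A⊢φ B⊢ψ n w ρ σ
  rewrite foldr-× (DFA.step A) (DFA.step B) (DFA.start A) (DFA.start B) (annotate w ρ σ)
        = cong₂ _∧_ (A⊢φ n w ρ σ) (B⊢ψ n w ρ σ)

withSet : Bool → Letter k m → Letter k (suc m)
withSet b (s , xs , Xs) = s , xs , b ∷ Xs

module SubsetConstruction (A : DFA k (suc m)) where
  open DFA A
  open Finite finite

  successors : Letter k m → State → Fin size → Bool
  successors l q c = (index (step (withSet false l) q) == c) ∨ (index (step (withSet true l) q) == c)

  -- The states of A reachable under some choice of the new set variable, as a characteristic vector.
  dfa : DFA k m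
  dfa = record
    { State  = Vec Bool size
    ; finite = finite-Vec finite-Bool size
    ; start  = tabulateᵛ (index start ==_)
    ; step   = λ l Q → tabulateᵛ (λ c → ⋁ (λ c′ → lookup Q c′ ∧ successors l (element c′) c))
    ; accept = λ Q → ⋁ (λ c → lookup Q c ∧ accept (element c))
    }

  runWith : (Fin n → Letter k m) → (Fin n → Bool) → State
  runWith ls S = run A (λ i → withSet (S i) (ls i))

  reachable : (ls : Fin n → Letter k m) (c : Fin size) →
              lookup (run dfa ls) c ≡ any (λ S → index (runWith ls S) == c) (subsets n)
  reachable {zero}  ls c = trans (lookup∘tabulate (index start ==_) c) (sym (∨-identityʳ _))
  reachable {suc n} ls c = begin
    lookup (run dfa ls) c
      ≡⟨ lookup∘tabulate _ c ⟩
    ⋁ (λ c′ → lookup (run dfa (ls ∘ suc)) c′ ∧ successors (ls zero) (element c′) c)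
      ≡⟨ foldr-cong _∨_ false (λ c′ → cong (_∧ successors (ls zero) (element c′) c) (reachable (ls ∘ suc) c′)) ⟩
    ⋁ (λ c′ → any (λ S → index (runWith (ls ∘ suc) S) == c′) (subsets n) ∧ successors (ls zero) (element c′) c)
      ≡⟨ ⋁-image (index ∘ runWith (ls ∘ suc)) (λ c′ → successors (ls zero) (element c′) c) (subsets n) ⟩
    any (λ S → successors (ls zero) (element (index (runWith (ls ∘ suc) S))) c) (subsets n)
      ≡⟨ any-cong (λ S → cong (λ q → successors (ls zero) q c) (element-index _)) (subsets n) ⟩
    any (λ S → index (runWith ls (consB false S)) == c ∨ index (runWith ls (consB true S)) == c) (subsets n)
      ≡⟨ any-subsets-suc (λ S → index (runWith ls S) == c) ⟨
    any (λ S → index (runWith ls S) == c) (subsets (suc n)) ∎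
    where open ≡-Reasoning

  accepts : (ls : Fin n → Letter k m) → DFA.accept dfa (run dfa ls) ≡ any (accept ∘ runWith ls) (subsets n)
  accepts {n} ls = begin
    ⋁ (λ c → lookup (run dfa ls) c ∧ accept (element c))
      ≡⟨ foldr-cong _∨_ false (λ c → cong (_∧ accept (element c)) (reachable ls c)) ⟩
    ⋁ (λ c → any (λ S → index (runWith ls S) == c) (subsets n) ∧ accept (element c))
      ≡⟨ ⋁-image (index ∘ runWith ls) (accept ∘ element) (subsets n) ⟩
    any (λ S → accept (element (index (runWith ls S)))) (subsets n)
      ≡⟨ any-cong (λ S → cong accept (element-index _)) (subsets n) ⟩
    any (accept ∘ runWith ls) (subsets n) ∎
    where open ≡-Reasoning

  decides : (φ : Formula k (suc m)) → Decides A φ → Decides dfa (ex2 φ)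
  decides φ A⊢φ n w ρ σ = trans (accepts (annotate w ρ σ)) (any-cong (λ S → A⊢φ n w ρ (extend S σ)) (subsets n))

-- What a counting quantifier needs to know about the number of witnesses: its image in a finite
-- homomorphic image of (ℕ, 0, +).
record Counter : Set₁ where
  field
    Value  : Set
    finite : Finite Value
    ε      : Value
    _∙_    : Value → Value → Value
    ⟦_⟧    : ℕ → Value
    ⟦0⟧    : ⟦ 0 ⟧ ≡ ε
    ⟦+⟧    : ∀ a b → ⟦ a + b ⟧ ≡ ⟦ a ⟧ ∙ ⟦ b ⟧

withPointer : Bool → Letter k m → Letter (suc k) m
withPointer b (s , xs , Xs) = s , b ∷ xs , Xs

pointAt : Fin n → (Fin n → Letter k m) → Fin n → Letter (suc k) m
pointAt a ls i = withPointer (a == i) (ls i)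

module CountingConstruction (K : Counter) (test : Counter.Value K → Bool) (A : DFA (suc k) m) where
  open Counter K using (Value; ε; _∙_; ⟦_⟧; ⟦0⟧; ⟦+⟧)
  open DFA A
  open Finite finite

  ⨁ : (Fin n → Value) → Value
  ⨁ = foldr _∙_ ε

  select : Bool → Value → Value
  select b v = if b then v else ε

  ⟦∑⟧ : (f : Fin n → ℕ) → ⟦ ∑ f ⟧ ≡ ⨁ (⟦_⟧ ∘ f)
  ⟦∑⟧ {zero}  f = ⟦0⟧
  ⟦∑⟧ {suc n} f = trans (⟦+⟧ (f zero) _) (cong (⟦ f zero ⟧ ∙_) (⟦∑⟧ (f ∘ suc)))

  ⟦if⟧ : ∀ b x → ⟦ if b then x else 0 ⟧ ≡ select b ⟦ x ⟧
  ⟦if⟧ b x = trans (if-float ⟦_⟧ b) (cong (if b then ⟦ x ⟧ else_) ⟦0⟧)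

  -- Besides the run of A with the new variable unset, a state keeps for every state c of A the image of
  -- the number of positions at which setting the variable leads A to c.
  dfa : DFA k m
  dfa = record
    { State  = State × Vec Value size
    ; finite = finite-× finite (finite-Vec (Counter.finite K) size)
    ; start  = start , tabulateᵛ (λ _ → ε)
    ; step   = λ l (q , tally) →
        step (withPointer false l) q ,
        tabulateᵛ (λ c → select (index (step (withPointer true l) q) == c) ⟦ 1 ⟧
                         ∙ ⨁ (λ c′ → select (index (step (withPointer false l) (element c′)) == c) (lookup tally c′)))
    ; accept = λ (_ , tally) → test (⨁ (λ c → select (accept (element c)) (lookup tally c)))
    }

  fibre : (Fin n → Letter k m) → Fin size → ℕ
  fibre ls c = # (λ a → index (run A (pointAt a ls)) == c)

  run-unpointed : (ls : Fin n → Letter k m) → proj₁ (run dfa ls) ≡ run A (withPointer false ∘ ls)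
  run-unpointed {zero}  ls = refl
  run-unpointed {suc n} ls = cong (step (withPointer false (ls zero))) (run-unpointed (ls ∘ suc))

  fibre-suc : (ls : Fin (suc n) → Letter k m) (c : Fin size) →
              fibre ls c ≡ 𝟙 (index (step (withPointer true (ls zero)) (run A (withPointer false ∘ ls ∘ suc))) == c)
                           + ∑ (λ c′ → if index (step (withPointer false (ls zero)) (element c′)) == c
                                        then fibre (ls ∘ suc) c′ else 0)
  fibre-suc ls c = cong (𝟙 (index (step (withPointer true (ls zero)) (run A (withPointer false ∘ ls ∘ suc))) == c) +_)
                        (#-fibres finite (λ a → run A (pointAt a (ls ∘ suc)))
                                  (λ q → index (step (withPointer false (ls zero)) q) == c))

  run-tally : (ls : Fin n → Letter k m) (c : Fin size) → lookup (proj₂ (run dfa ls)) c ≡ ⟦ fibre ls c ⟧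
  run-tally {zero}  ls c = trans (lookup∘tabulate (λ _ → ε) c) (sym ⟦0⟧)
  run-tally {suc n} ls c = begin
    lookup (proj₂ (run dfa ls)) c
      ≡⟨ lookup∘tabulate _ c ⟩
    select (here (proj₁ (run dfa (ls ∘ suc)))) ⟦ 1 ⟧
      ∙ ⨁ (λ c′ → select (later c′) (lookup (proj₂ (run dfa (ls ∘ suc))) c′))
      ≡⟨ cong₂ _∙_ (cong (λ q → select (here q) ⟦ 1 ⟧) (run-unpointed (ls ∘ suc)))
                   (foldr-cong _∙_ ε (λ c′ → cong (select (later c′)) (run-tally (ls ∘ suc) c′))) ⟩
    select (here unpointed) ⟦ 1 ⟧ ∙ ⨁ (λ c′ → select (later c′) ⟦ fibre (ls ∘ suc) c′ ⟧)
      ≡⟨ cong₂ _∙_ (⟦if⟧ (here unpointed) 1)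
                   (trans (⟦∑⟧ (λ c′ → if later c′ then fibre (ls ∘ suc) c′ else 0))
                          (foldr-cong _∙_ ε (λ c′ → ⟦if⟧ (later c′) (fibre (ls ∘ suc) c′)))) ⟨
    ⟦ 𝟙 (here unpointed) ⟧ ∙ ⟦ ∑ (λ c′ → if later c′ then fibre (ls ∘ suc) c′ else 0) ⟧
      ≡⟨ trans (cong ⟦_⟧ (fibre-suc ls c)) (⟦+⟧ _ _) ⟨
    ⟦ fibre ls c ⟧ ∎
    where
    open ≡-Reasoning
    unpointed : State
    unpointed = run A (withPointer false ∘ ls ∘ suc)
    here : State → Bool
    here q = index (step (withPointer true (ls zero)) q) == c
    later : Fin size → Bool
    later c′ = index (step (withPointer false (ls zero)) (element c′)) == c

  accepts : (ls : Fin n → Letter k m) → DFA.accept dfa (run dfa ls) ≡ test ⟦ # (λ a → accept (run A (pointAt a ls))) ⟧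
  accepts ls = cong test (begin
    ⨁ (λ c → select (accept (element c)) (lookup (proj₂ (run dfa ls)) c))
      ≡⟨ foldr-cong _∙_ ε (λ c → trans (cong (select (accept (element c))) (run-tally ls c))
                                       (sym (⟦if⟧ (accept (element c)) (fibre ls c)))) ⟩
    ⨁ (λ c → ⟦ if accept (element c) then fibre ls c else 0 ⟧)
      ≡⟨ ⟦∑⟧ (λ c → if accept (element c) then fibre ls c else 0) ⟨
    ⟦ ∑ (λ c → if accept (element c) then fibre ls c else 0) ⟧
      ≡⟨ cong ⟦_⟧ (#-fibres finite (λ a → run A (pointAt a ls)) accept) ⟨
    ⟦ # (λ a → accept (run A (pointAt a ls))) ⟧ ∎)
    where open ≡-Reasoning

  decides-count : (φ : Formula (suc k) m) → Decides A φ → ∀ n w ρ σ →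
                  DFA.accept dfa (run dfa (annotate w ρ σ))
                  ≡ test ⟦ # (λ a → eval (bipartite w) (natural n) φ (extend a ρ) σ) ⟧
  decides-count φ A⊢φ n w ρ σ =
    trans (accepts (annotate w ρ σ)) (cong (test ∘ ⟦_⟧) (foldr-cong _+_ 0 (λ a → cong 𝟙 (A⊢φ n w (extend a ρ) σ))))

nonzeroCounter : Counter
nonzeroCounter = record
  { Value  = Bool
  ; finite = finite-Bool
  ; ε      = false
  ; _∙_    = _∨_
  ; ⟦_⟧    = 0 <ᵇ_
  ; ⟦0⟧    = refl
  ; ⟦+⟧    = λ { zero b → refl ; (suc a) b → refl }
  }

moduloCounter : ∀ p → {{NonZero p}} → Counter
moduloCounter p = record
  { Value  = Fin p
  ; finite = finite-Fin
  ; ε      = 0 mod p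
  ; _∙_    = λ a b → (toℕ a + toℕ b) mod p
  ; ⟦_⟧    = _mod p
  ; ⟦0⟧    = refl
  ; ⟦+⟧    = λ a b → toℕ-injective (begin
      toℕ ((a + b) mod p)                  ≡⟨ toℕ-fromℕ< _ ⟩
      (a + b) % p                          ≡⟨ %-distribˡ-+ a b p ⟩
      (a % p + b % p) % p
        ≡⟨ cong₂ (λ x y → (x + y) % p) (toℕ-fromℕ< (m%n<n a p)) (toℕ-fromℕ< (m%n<n b p)) ⟨
      (toℕ (a mod p) + toℕ (b mod p)) % p  ≡⟨ toℕ-fromℕ< _ ⟨
      toℕ ((toℕ (a mod p) + toℕ (b mod p)) mod p) ∎)
  }
  where open ≡-Reasoning

⋁≡0<ᵇ# : (P : Fin n → Bool) → ⋁ P ≡ (0 <ᵇ # P)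
⋁≡0<ᵇ# {zero}  P = refl
⋁≡0<ᵇ# {suc n} P with P zero
... | true  = refl
... | false = ⋁≡0<ᵇ# (P ∘ suc)

existsDFA : DFA (suc k) m → DFA k m
existsDFA = CountingConstruction.dfa nonzeroCounter id

existsDFA-decides : (A : DFA (suc k) m) (φ : Formula (suc k) m) → Decides A φ → Decides (existsDFA A) (ex1 φ)
existsDFA-decides A φ A⊢φ n w ρ σ = begin
  _ ≡⟨ CountingConstruction.decides-count nonzeroCounter id A φ A⊢φ n w ρ σ ⟩
  0 <ᵇ # P ≡⟨ ⋁≡0<ᵇ# P ⟨
  ⋁ P ≡⟨ any≡⋁ P ⟨
  any P (allFin n) ∎
  where
  open ≡-Reasoning
  P = λ a → eval (bipartite w) (natural n) φ (extend a ρ) σ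

countDFA : (p : ℕ) → {{NonZero p}} → ℕ → DFA (suc k) m → DFA k m
countDFA p i = CountingConstruction.dfa (moduloCounter p) (λ c → toℕ c ≡ᵇ i % p)

countDFA-decides : (p : ℕ) {{_ : NonZero p}} (i : ℕ) (A : DFA (suc k) m) (φ : Formula (suc k) m) →
                   Decides A φ → Decides (countDFA p i A) (cnt p i φ)
countDFA-decides p i A φ A⊢φ n w ρ σ =
  trans (CountingConstruction.decides-count (moduloCounter p) (λ c → toℕ c ≡ᵇ i % p) A φ A⊢φ n w ρ σ)
        (cong (λ c → c ≡ᵇ i % p) (trans (toℕ-fromℕ< _) (cong (_% p) (sym (count≡# P)))))
  where P = λ a → eval (bipartite w) (natural n) φ (extend a ρ) σ

compile : Formula k m → DFA k m
compile (edge x y)  = edgeDFA x y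
compile (less x y)  = lessDFA x y
compile (equal x y) = equalDFA x y
compile (mem x X)   = memDFA x X
compile (neg φ)     = negDFA (compile φ)
compile (conj φ ψ)  = conjDFA (compile φ) (compile ψ)
compile (ex1 φ)     = existsDFA (compile φ)
compile (ex2 φ)     = SubsetConstruction.dfa (compile φ)
compile (cnt p i φ) = countDFA p i (compile φ)

compile-decides : (φ : Formula k m) → Decides (compile φ) φ
compile-decides (edge x y)  = edgeDFA-decides x y
compile-decides (less x y)  = lessDFA-decides x y
compile-decides (equal x y) = equalDFA-decides x y
compile-decides (mem x X)   = memDFA-decides x X
compile-decides (neg φ)     = negDFA-decides (compile φ) φ (compile-decides φ)
compile-decides (conj φ ψ)  = conjDFA-decides (compile φ) (compile ψ) φ ψ (compile-decides φ) (compile-decides ψ)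
compile-decides (ex1 φ)     = existsDFA-decides (compile φ) φ (compile-decides φ)
compile-decides (ex2 φ)     = SubsetConstruction.decides (compile φ) φ (compile-decides φ)
compile-decides (cnt p i φ) = countDFA-decides p i (compile φ) φ (compile-decides φ)

-- Pumping

module _ (A : DFA 0 0) where
  open DFA A

  inFirst inSecond : State → State
  inFirst  = step (true , [] , [])
  inSecond = step (false , [] , [])

  run-K : ∀ a b → run A (annotate (firstSide a b) (λ ()) (λ ())) ≡ fold (fold start inSecond b) inFirst a
  run-K zero    zero    = refl
  run-K zero    (suc b) = cong inSecond (run-K zero b)
  run-K (suc a) b       = cong inFirst (run-K a b)

  pumping : ∃₂ λ a b → 2 ≤ a × a < b × fold start inSecond a ≡ fold start inSecond b
  -- The offset 2 gives a ≥ 2, which K a a needs to be Hamiltonian and a cage.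
  pumping with pigeonhole (n<1+n size) (λ t → index (fold start inSecond (2 + toℕ t)))
    where open Finite finite
  ... | t , u , t<u , same = 2 + toℕ t , 2 + toℕ u , s≤s (s≤s z≤n) , s≤s (s≤s t<u) ,
    trans (sym (element-index _)) (trans (cong element same) (element-index _))
    where open Finite finite

indistinguishable : (φ : Sentence) →
  ∃₂ λ a b → 2 ≤ a × a < b × (K a a , natural (a + a) ⊨ φ → K a b , natural (a + b) ⊨ φ)
indistinguishable φ with pumping (compile φ)
... | a , b , 2≤a , a<b , same = a , b , 2≤a , a<b , λ Kaa⊨φ → begin
  eval (K a b) (natural (a + b)) φ (λ ()) (λ ())
    ≡⟨ compile-decides φ (a + b) (firstSide a b) (λ ()) (λ ()) ⟨
  accept (run D (annotate (firstSide a b) (λ ()) (λ ())))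
    ≡⟨ cong accept (run-K D a b) ⟩
  accept (fold (fold start (inSecond D) b) (inFirst D) a)
    ≡⟨ cong (λ q → accept (fold q (inFirst D) a)) same ⟨
  accept (fold (fold start (inSecond D) a) (inFirst D) a)
    ≡⟨ cong accept (run-K D a a) ⟨
  accept (run D (annotate (firstSide a a) (λ ()) (λ ())))
    ≡⟨ compile-decides φ (a + a) (firstSide a a) (λ ()) (λ ()) ⟩
  eval (K a a) (natural (a + a)) φ (λ ()) (λ ())
    ≡⟨ Kaa⊨φ ⟩
  true ∎
  where
  D = compile φ
  open DFA D
  open ≡-Reasoning

notDefinable : (C : GraphClass) → (∀ {a} → 2 ≤ a → C (K a a)) → (∀ {a b} → 0 < a → a < b → ¬ C (K a b)) →
               ¬ CMSOLDefinableWithOrder C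
notDefinable C C-Kaa ¬C-Kab (φ , defines) with indistinguishable φ
... | a , b , 2≤a , a<b , transfer =
  ¬C-Kab (≤-trans (s≤s z≤n) 2≤a) a<b
    (Equivalence.to (defines _ (K a b) (natural _))
      (transfer (Equivalence.from (defines _ (K a a) (natural _)) (C-Kaa 2≤a))))

-- The graphs K a b

firstSide-↑ˡ : ∀ a b (i : Fin a) → firstSide a b (i ↑ˡ b) ≡ true
firstSide-↑ˡ a b i rewrite toℕ-↑ˡ i b = <⇒<ᵇ≡true (toℕ<n i)

firstSide-↑ʳ : ∀ a b (j : Fin b) → firstSide a b (a ↑ʳ j) ≡ false
firstSide-↑ʳ a b j rewrite toℕ-↑ʳ a j = ≮⇒<ᵇ≡false (m+n≮m a (toℕ j))

#-firstSide : ∀ a b → # (firstSide a b) ≡ a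
#-firstSide zero    b = ∑-zero {b} (λ _ → refl)
#-firstSide (suc a) b = cong suc (#-firstSide a b)

#-secondSide : ∀ a b → # (not ∘ firstSide a b) ≡ b
#-secondSide zero    b = #-true
#-secondSide (suc a) b = #-secondSide a b

degree-K : ∀ a b v → degree (K a b) v ≡ (if firstSide a b v then b else a)
degree-K a b v rewrite count≡# (λ u → firstSide a b v xor firstSide a b u) with firstSide a b v
... | true  = #-secondSide a b
... | false = #-firstSide a b

K-unbalanced : ∀ {a b} → a < b → # (firstSide a b) ≢ # (not ∘ firstSide a b)
K-unbalanced {a} {b} a<b eq = <⇒≢ a<b (trans (sym (#-firstSide a b)) (trans eq (#-secondSide a b)))

next : Fin (suc n) → Fin (suc n)
next {zero}  zero    = zero
next {suc n} zero    = suc zero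
next {suc n} (suc i) with next i
... | zero  = zero
... | suc j = suc (suc j)

next-CycSucc : (i : Fin (suc n)) → CycSucc i (next i)
next-CycSucc {zero}  zero    = inj₂ (refl , refl)
next-CycSucc {suc n} zero    = inj₁ refl
next-CycSucc {suc n} (suc i) with next i | next-CycSucc i
... | zero  | inj₂ (i-last , _) = inj₂ (cong suc i-last , refl)
... | suc j | inj₁ j≡1+i        = inj₁ (cong suc j≡1+i)

CycSucc-injectiveˡ : ∀ {ℓ} {i j k : Fin ℓ} → CycSucc i k → CycSucc j k → i ≡ j
CycSucc-injectiveˡ (inj₁ k≡1+i)      (inj₁ k≡1+j)      = toℕ-injective (cong pred (trans (sym k≡1+i) k≡1+j))
CycSucc-injectiveˡ (inj₂ (i-last , _)) (inj₂ (j-last , _)) = toℕ-injective (trans i-last (sym j-last))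
CycSucc-injectiveˡ (inj₁ k≡1+i)      (inj₂ (_ , k≡0))  = contradiction (trans (sym k≡1+i) k≡0) λ ()
CycSucc-injectiveˡ (inj₂ (_ , k≡0))  (inj₁ k≡1+j)      = contradiction (trans (sym k≡1+j) k≡0) λ ()

toℕ≡suc-last-absurd : ∀ {ℓ} {i j : Fin ℓ} → toℕ i ≡ ℓ ∸ 1 → toℕ j ≢ suc (toℕ i)
toℕ≡suc-last-absurd {suc ℓ} {i} {j} i-last j≡1+i = <-irrefl (trans j≡1+i (cong suc i-last)) (toℕ<n j)

CycSucc-functional : ∀ {ℓ} {i j k : Fin ℓ} → CycSucc i j → CycSucc i k → j ≡ k
CycSucc-functional (inj₁ j≡1+i)        (inj₁ k≡1+i)        = toℕ-injective (trans j≡1+i (sym k≡1+i))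
CycSucc-functional (inj₂ (_ , j≡0))    (inj₂ (_ , k≡0))    = toℕ-injective (trans j≡0 (sym k≡0))
CycSucc-functional (inj₁ j≡1+i)        (inj₂ (i-last , _)) = contradiction j≡1+i (toℕ≡suc-last-absurd i-last)
CycSucc-functional (inj₂ (i-last , _)) (inj₁ k≡1+i)        = contradiction k≡1+i (toℕ≡suc-last-absurd i-last)

next-injective : Injective _≡_ _≡_ (next {n})
next-injective {x = i} {y = j} eq = CycSucc-injectiveˡ (next-CycSucc i) (subst (CycSucc j) (sym eq) (next-CycSucc j))

hamiltonian⇒balanced : (w : Fin n → Bool) → Hamiltonian (bipartite w) → # w ≡ # (not ∘ w)
hamiltonian⇒balanced {zero}  w _                          = refl
hamiltonian⇒balanced {suc n} w (_ , c , c-inj , adjacent) = begin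
  # w               ≡⟨ #∘injective c c-inj w ⟨
  # (w ∘ c)         ≡⟨ alternating⇒balanced next next-injective (w ∘ c) alternates ⟩
  # (not ∘ w ∘ c)   ≡⟨ #∘injective c c-inj (not ∘ w) ⟩
  # (not ∘ w)       ∎
  where
  open ≡-Reasoning
  alternates : ∀ i → w (c (next i)) ≡ not (w (c i))
  alternates i = xor≡true⇒≡not _ _ (adjacent i (next i) (next-CycSucc i))

even : ℕ → Bool
even zero          = true
even (suc zero)    = false
even (suc (suc n)) = even n

even-suc : ∀ n → even (suc n) ≡ not (even n)
even-suc zero          = refl
even-suc (suc zero)    = refl
even-suc (suc (suc n)) = even-suc n

even-double : ∀ n → even (n + n) ≡ true
even-double zero    = refl
even-double (suc n) rewrite +-suc n n = even-double n

even-⌊/2⌋-injective : ∀ m n → even m ≡ even n → ⌊ m /2⌋ ≡ ⌊ n /2⌋ → m ≡ n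
even-⌊/2⌋-injective zero                zero                _ _ = refl
even-⌊/2⌋-injective (suc zero)          (suc zero)          _ _ = refl
even-⌊/2⌋-injective (suc (suc m))       (suc (suc n))       e h =
  cong (2 +_) (even-⌊/2⌋-injective m n e (cong pred h))
even-⌊/2⌋-injective zero                (suc zero)          () _
even-⌊/2⌋-injective (suc zero)          zero                () _
even-⌊/2⌋-injective zero                (suc (suc n))       _ ()
even-⌊/2⌋-injective (suc (suc m))       zero                _ ()
even-⌊/2⌋-injective (suc zero)          (suc (suc n))       _ ()
even-⌊/2⌋-injective (suc (suc m))       (suc zero)          _ ()

⌊/2⌋-< : ∀ n m → n < m + m → ⌊ n /2⌋ < m
⌊/2⌋-< zero          (suc m) _   = s≤s z≤n
⌊/2⌋-< (suc zero)    (suc m) _   = s≤s z≤n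
⌊/2⌋-< (suc (suc n)) (suc m) n<m rewrite +-suc m m = s≤s (⌊/2⌋-< n m (s≤s⁻¹ (s≤s⁻¹ n<m)))

module _ {a b c : ℕ} (c≤a : c ≤ a) (c≤b : c ≤ b) where

  sideVertex : Bool → (h : ℕ) → h < c → Fin (a + b)
  sideVertex true  h h<c = fromℕ< (<-≤-trans h<c c≤a) ↑ˡ b
  sideVertex false h h<c = a ↑ʳ fromℕ< (<-≤-trans h<c c≤b)

  firstSide-sideVertex : ∀ s h (h<c : h < c) → firstSide a b (sideVertex s h h<c) ≡ s
  firstSide-sideVertex true  h h<c = firstSide-↑ˡ a b _
  firstSide-sideVertex false h h<c = firstSide-↑ʳ a b _

  sideVertex-injective : ∀ s s′ h h′ (h<c : h < c) (h′<c : h′ < c) →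
                    sideVertex s h h<c ≡ sideVertex s′ h′ h′<c → s ≡ s′ × h ≡ h′
  sideVertex-injective true  true  h h′ h<c h′<c eq =
    refl , trans (sym (toℕ-fromℕ< _)) (trans (cong toℕ (↑ˡ-injective b _ _ eq)) (toℕ-fromℕ< _))
  sideVertex-injective false false h h′ h<c h′<c eq =
    refl , trans (sym (toℕ-fromℕ< _)) (trans (cong toℕ (↑ʳ-injective a _ _ eq)) (toℕ-fromℕ< _))
  sideVertex-injective true  false h h′ h<c h′<c eq =
    contradiction (trans (sym (firstSide-sideVertex true h h<c)) (trans (cong (firstSide a b) eq) (firstSide-sideVertex false h′ h′<c))) λ ()
  sideVertex-injective false true  h h′ h<c h′<c eq =
    contradiction (trans (sym (firstSide-sideVertex false h h<c)) (trans (cong (firstSide a b) eq) (firstSide-sideVertex true h′ h′<c))) λ ()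

evenCycle : ∀ {a b c} → 2 ≤ c → c ≤ a → c ≤ b → HasCycleOfLength (K a b) (c + c)
evenCycle {a} {b} {suc c′} 2≤c c≤a c≤b = ≤-trans (n≤1+n 3) (+-mono-≤ 2≤c 2≤c) , vertex , vertex-injective , adjacent
  where
  c = suc c′

  vertex : Fin (c + c) → Fin (a + b)
  vertex t = sideVertex c≤a c≤b (even (toℕ t)) ⌊ toℕ t /2⌋ (⌊/2⌋-< (toℕ t) c (toℕ<n t))

  firstSide-vertex : ∀ t → firstSide a b (vertex t) ≡ even (toℕ t)
  firstSide-vertex t = firstSide-sideVertex c≤a c≤b _ _ _

  vertex-injective : Injective _≡_ _≡_ vertex
  vertex-injective {t} {u} eq with sideVertex-injective c≤a c≤b _ _ _ _ _ _ eq
  ... | same-parity , same-half = toℕ-injective (even-⌊/2⌋-injective (toℕ t) (toℕ u) same-parity same-half)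

  last-odd : even (c + c ∸ 1) ≡ false
  last-odd rewrite +-suc c′ c′ = trans (even-suc (c′ + c′)) (cong not (even-double c′))

  parity-flips : ∀ {t u} → CycSucc t u → even (toℕ u) ≡ not (even (toℕ t))
  parity-flips {t} (inj₁ u≡1+t)       rewrite u≡1+t = even-suc (toℕ t)
  parity-flips     (inj₂ (t-last , u≡0)) rewrite t-last | u≡0 | last-odd = refl

  adjacent : ∀ t u → CycSucc t u → E (K a b) (vertex t) (vertex u) ≡ true
  adjacent t u t→u rewrite firstSide-vertex t | firstSide-vertex u | parity-flips t→u = xor-inverseʳ (even (toℕ t))

hamiltonian-K : ∀ {a} → 2 ≤ a → Hamiltonian (K a a)
hamiltonian-K 2≤a = evenCycle 2≤a ≤-refl ≤-refl

¬hamiltonian-K : ∀ {a b} → a < b → ¬ Hamiltonian (K a b)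
¬hamiltonian-K a<b = K-unbalanced a<b ∘ hamiltonian⇒balanced _

perfectMatching⇒balanced : (w : Fin n → Bool) → HasPerfectMatching (bipartite w) → # w ≡ # (not ∘ w)
perfectMatching⇒balanced {n} w (M , M⊆E , M-sym , unique) =
  alternating⇒balanced mate mate-injective w (λ v → xor≡true⇒≡not _ _ (M⊆E v (mate v) (matched v)))
  where
  mate : Fin n → Fin n
  mate v = proj₁ (unique v)
  matched : ∀ v → M v (mate v) ≡ true
  matched v = proj₁ (proj₂ (unique v))
  mate-involutive : ∀ v → v ≡ mate (mate v)
  mate-involutive v = proj₂ (proj₂ (unique (mate v))) v (trans (M-sym (mate v) v) (matched v))
  mate-injective : Injective _≡_ _≡_ mate
  mate-injective {u} {v} eq = trans (mate-involutive u) (trans (cong mate eq) (sym (mate-involutive v)))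

partner : ∀ a → Fin (a + a) → Fin (a + a)
partner a = join a a ∘ swap ∘ splitAt a

partner-involutive : ∀ a u → partner a (partner a u) ≡ u
partner-involutive a u = begin
  join a a (swap (splitAt a (join a a (swap (splitAt a u)))))  ≡⟨ cong (join a a ∘ swap) (splitAt-join a a (swap (splitAt a u))) ⟩
  join a a (swap (swap (splitAt a u)))                          ≡⟨ cong (join a a) (swap-involutive (splitAt a u)) ⟩
  join a a (splitAt a u)                                        ≡⟨ join-splitAt a a u ⟩
  u                                                             ∎
  where open ≡-Reasoning

firstSide-partner : ∀ a u → firstSide a a (partner a u) ≡ not (firstSide a a u)
firstSide-partner a u with splitAt a u in eq
... | inj₁ i = trans (firstSide-↑ʳ a a i)
                     (cong not (sym (trans (cong (firstSide a a) (sym (splitAt⁻¹-↑ˡ eq))) (firstSide-↑ˡ a a i))))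
... | inj₂ j = trans (firstSide-↑ˡ a a j)
                     (cong not (sym (trans (cong (firstSide a a) (sym (splitAt⁻¹-↑ʳ eq))) (firstSide-↑ʳ a a j))))

perfectMatching-K : ∀ a → HasPerfectMatching (K a a)
perfectMatching-K a = (λ u v → partner a u == v) , matched⇒adjacent , ==-involution (partner a) (partner-involutive a) ,
  λ v → partner a v , ==-refl (partner a v) , λ u matched → sym (==⇒≡ _ _ matched)
  where
  matched⇒adjacent : ∀ u v → (partner a u == v) ≡ true → E (K a a) u v ≡ true
  matched⇒adjacent u v matched with ==⇒≡ (partner a u) v matched
  ... | refl rewrite firstSide-partner a u = xor-inverseʳ (firstSide a a u)

¬perfectMatching-K : ∀ {a b} → a < b → ¬ HasPerfectMatching (K a b)
¬perfectMatching-K a<b = K-unbalanced a<b ∘ perfectMatching⇒balanced _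

module _ (G H : Graph n) (same : ∀ u v → E G u v ≡ E H u v) where

  VertexCover-cong : {S : Fin n → Bool} → VertexCover G S → VertexCover H S
  VertexCover-cong cov u v uv = cov u v (trans (same u v) uv)

  MinimalVertexCover-cong : {S : Fin n → Bool} → MinimalVertexCover G S → MinimalVertexCover H S
  MinimalVertexCover-cong (cov , minimal) =
    VertexCover-cong cov , λ T T⊆S T-cov → minimal T T⊆S (VertexCover-cong′ T-cov)
    where
    VertexCover-cong′ : {T : Fin n → Bool} → VertexCover H T → VertexCover G T
    VertexCover-cong′ cov u v uv = cov u v (trans (sym (same u v)) uv)

bipartite-not : (w : Fin n → Bool) → ∀ u v → E (bipartite (not ∘ w)) u v ≡ E (bipartite w) u v
bipartite-not w u v = xor-annihilates-not (w u) (w v)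

side-isVertexCover : (w : Fin n → Bool) → VertexCover (bipartite w) w
side-isVertexCover w u v uv with w u | w v
... | true  | _     = inj₁ refl
... | false | true  = inj₂ refl
... | false | false = contradiction uv λ ()

otherSide-isVertexCover : (w : Fin n → Bool) → VertexCover (bipartite w) (not ∘ w)
otherSide-isVertexCover w = VertexCover-cong (bipartite (not ∘ w)) (bipartite w) (bipartite-not w) (side-isVertexCover (not ∘ w))

side-isMinimal : (w : Fin n → Bool) (u₀ : Fin n) → w u₀ ≡ false → MinimalVertexCover (bipartite w) w
side-isMinimal w u₀ wu₀ = side-isVertexCover w , minimal
  where
  minimal : ∀ T → (∀ v → T v ≡ true → w v ≡ true) → VertexCover (bipartite w) T → ∀ v → T v ≡ w v
  minimal T T⊆w T-cov v with w v in wv | T v in Tv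
  ... | false | false = refl
  ... | false | true  = contradiction (trans (sym wv) (T⊆w v Tv)) λ ()
  ... | true  | true  = refl
  ... | true  | false with T-cov v u₀ (cong₂ _xor_ wv wu₀)
  ...   | inj₁ Tv′ = contradiction (trans (sym Tv) Tv′) λ ()
  ...   | inj₂ Tu₀ = contradiction (trans (sym wu₀) (T⊆w u₀ Tu₀)) λ ()

otherSide-isMinimal : (w : Fin n → Bool) (u₁ : Fin n) → w u₁ ≡ true → MinimalVertexCover (bipartite w) (not ∘ w)
otherSide-isMinimal w u₁ wu₁ =
  MinimalVertexCover-cong (bipartite (not ∘ w)) (bipartite w) (bipartite-not w) (side-isMinimal (not ∘ w) u₁ (cong not wu₁))

minimalVertexCover-isSide : (w S : Fin n → Bool) → MinimalVertexCover (bipartite w) S →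
                            (∀ v → S v ≡ w v) ⊎ (∀ v → S v ≡ not (w v))
minimalVertexCover-isSide w S (cov , minimal) with any? (λ v → (w v ≟ᵇ true) ×-dec (S v ≟ᵇ false))
... | yes (v₀ , wv₀ , Sv₀) = inj₂ λ v → sym (minimal (not ∘ w) otherSide⊆S (otherSide-isVertexCover w) v)
  where
  otherSide⊆S : ∀ v → not (w v) ≡ true → S v ≡ true
  otherSide⊆S v w̄v with cov v₀ v (trans (cong (_xor w v) wv₀) w̄v)
  ... | inj₁ Sv₀′ = contradiction (trans (sym Sv₀) Sv₀′) λ ()
  ... | inj₂ Sv   = Sv
... | no none = inj₁ λ v → sym (minimal w side⊆S (side-isVertexCover w) v)
  where
  side⊆S : ∀ v → w v ≡ true → S v ≡ true
  side⊆S v wv with S v in Sv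
  ... | true  = refl
  ... | false = contradiction (v , wv , Sv) none

wellCovered-K : ∀ a → WellCovered (K a a)
wellCovered-K a S T S-min T-min = trans (size S S-min) (sym (size T T-min))
  where
  size : ∀ S → MinimalVertexCover (K a a) S → count S ≡ a
  size S S-min with minimalVertexCover-isSide (firstSide a a) S S-min
  ... | inj₁ S≗w = trans (count≡# S) (trans (foldr-cong _+_ 0 (cong 𝟙 ∘ S≗w)) (#-firstSide a a))
  ... | inj₂ S≗w̄ = trans (count≡# S) (trans (foldr-cong _+_ 0 (cong 𝟙 ∘ S≗w̄)) (#-secondSide a a))

¬wellCovered-K : ∀ {a b} → 0 < a → a < b → ¬ WellCovered (K a b)
¬wellCovered-K {suc a} {suc b} _ a<b wellCovered = K-unbalanced a<b (begin
  # w              ≡⟨ count≡# w ⟨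
  count w          ≡⟨ wellCovered w (not ∘ w) (side-isMinimal w (suc a ↑ʳ zero) (firstSide-↑ʳ (suc a) (suc b) zero))
                                              (otherSide-isMinimal w zero refl) ⟩
  count (not ∘ w)  ≡⟨ count≡# (not ∘ w) ⟩
  # (not ∘ w)      ∎)
  where
  w = firstSide (suc a) (suc b)
  open ≡-Reasoning

bipartite-noShortCycle : (w : Fin n → Bool) → ∀ ℓ → ℓ < 4 → ¬ HasCycleOfLength (bipartite w) ℓ
bipartite-noShortCycle w 3 _ (_ , c , _ , adjacent) =
  oddCycle (w (c 0F)) (w (c 1F)) (w (c 2F))
    (adjacent 0F 1F (inj₁ refl)) (adjacent 1F 2F (inj₁ refl)) (adjacent 2F 0F (inj₂ (refl , refl)))
  where
  oddCycle : ∀ x y z → x xor y ≡ true → y xor z ≡ true → z xor x ≡ true → ⊥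
  oddCycle true  true  _     ()
  oddCycle false false _     ()
  oddCycle true  false true  _ _ ()
  oddCycle true  false false _ ()
  oddCycle false true  true  _ ()
  oddCycle false true  false _ _ ()
bipartite-noShortCycle w 0 _ (() , _)
bipartite-noShortCycle w 1 _ (s≤s () , _)
bipartite-noShortCycle w 2 _ (s≤s (s≤s ()) , _)
bipartite-noShortCycle w (suc (suc (suc (suc _)))) (s≤s (s≤s (s≤s (s≤s ())))) _

triangle⇒cycle : (H : Graph n) {u v x : Fin n} → E H u v ≡ true → E H v x ≡ true → E H u x ≡ true →
                 HasCycleOfLength H 3
triangle⇒cycle {n} H {u} {v} {x} uv vx ux = s≤s (s≤s (s≤s z≤n)) , c , injective , adjacent
  where
  c : Fin 3 → Fin n
  c i = lookup (u ∷ v ∷ x ∷ []) i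

  distinct : ∀ {p q} → E H p q ≡ true → p ≢ q
  distinct {p} pq refl = contradiction (trans (sym (Graph.irrefl H p)) pq) λ ()

  injective : Injective _≡_ _≡_ c
  injective {0F} {0F} _ = refl
  injective {1F} {1F} _ = refl
  injective {2F} {2F} _ = refl
  injective {0F} {1F} e = contradiction e (distinct uv)
  injective {0F} {2F} e = contradiction e (distinct ux)
  injective {1F} {2F} e = contradiction e (distinct vx)
  injective {1F} {0F} e = contradiction (sym e) (distinct uv)
  injective {2F} {0F} e = contradiction (sym e) (distinct ux)
  injective {2F} {1F} e = contradiction (sym e) (distinct vx)

  around : ∀ i → E H (c i) (c (next i)) ≡ true
  around 0F = uv
  around 1F = vx
  around 2F = trans (Graph.sym H x u) ux

  adjacent : ∀ i j → CycSucc i j → E H (c i) (c j) ≡ true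
  adjacent i j i→j rewrite CycSucc-functional i→j (next-CycSucc i) = around i

regular-triangleFree⇒size : (H : Graph m) {r : ℕ} {u v : Fin m} → Regular H r → ¬ HasCycleOfLength H 3 →
                            E H u v ≡ true → r + r ≤ m
regular-triangleFree⇒size {m} H {r} {u} {v} regular triangleFree uv = begin
  r + r
    ≡⟨ cong₂ _+_ (trans (sym (regular u)) (count≡# (E H u))) (trans (sym (regular v)) (count≡# (E H v))) ⟩
  # (E H u) + # (E H v)
    ≡⟨ #-∨ (E H u) (E H v) noCommonNeighbour ⟨
  # (λ x → E H u x ∨ E H v x)
    ≤⟨ #-≤ (λ x → E H u x ∨ E H v x) ⟩
  m ∎
  where
  open ≤-Reasoning
  noCommonNeighbour : ∀ x → E H u x ∧ E H v x ≡ false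
  noCommonNeighbour x with E H u x in ux | E H v x in vx
  ... | true  | true  = contradiction (triangle⇒cycle H uv vx ux) triangleFree
  ... | true  | false = refl
  ... | false | _     = refl

cage-K : ∀ {a} → 2 ≤ a → Cage (K a a)
cage-K {a} 2≤a = a , 4 , regular , (evenCycle ≤-refl 2≤a 2≤a , bipartite-noShortCycle (firstSide a a)) , smallest
  where
  regular : Regular (K a a) a
  regular v = trans (degree-K a a v) (if-eta (firstSide a a v))
  smallest : ∀ m (H : Graph m) → Regular H a → Girth H 4 → a + a ≤ m
  smallest m H H-regular ((_ , c , _ , adjacent) , noShortCycle) =
    regular-triangleFree⇒size H H-regular (noShortCycle 3 ≤-refl) (adjacent 0F 1F (inj₁ refl))

¬cage-K : ∀ {a b} → 0 < a → a < b → ¬ Cage (K a b)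
¬cage-K {suc a} {suc b} _ a<b (r , _ , regular , _) = <⇒≢ a<b (trans (sym r≡1+a) r≡1+b)
  where
  r≡1+b : r ≡ suc b
  r≡1+b = trans (sym (regular zero)) (degree-K (suc a) (suc b) zero)
  r≡1+a : r ≡ suc a
  r≡1+a = trans (sym (regular (suc a ↑ʳ zero)))
                (trans (degree-K (suc a) (suc b) (suc a ↑ʳ zero))
                       (cong (if_then suc b else suc a) (firstSide-↑ʳ (suc a) (suc b) zero)))

corollary6p9 : ¬ CMSOLDefinableWithOrder Hamiltonian
             × ¬ CMSOLDefinableWithOrder HasPerfectMatching
             × ¬ CMSOLDefinableWithOrder Cage
             × ¬ CMSOLDefinableWithOrder WellCovered
corollary6p9 =
    notDefinable Hamiltonian        hamiltonian-K                   (λ _ → ¬hamiltonian-K)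
  , notDefinable HasPerfectMatching (λ {a} _ → perfectMatching-K a) (λ _ → ¬perfectMatching-K)
  , notDefinable Cage               cage-K                          ¬cage-K
  , notDefinable WellCovered        (λ {a} _ → wellCovered-K a)     ¬wellCovered-K
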